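{- Let $k$ be even, $1\le k<n$, and let $\gamma$ be the smallest positive integer that does not divide $k$. (1) If $\gamma$ divides $n$, then $m(1,J(n,k))\le(\lfloor\gamma/2\rfloor+1)k+1$. (2) If $\gamma$ does not divide $n$, then $m(1,J(n,k))\le(\lfloor\gamma/2\rfloor+1)(2k+\beta-1)+1$, where $\beta$ is the remainder of $n-(k+1)$ on division by $\gamma$.
   Context: $J(n,k)$ is the Johnson graph on the $k$-subsets of $\{1,\dots,n\}$ (adjacent iff they meet in $k-1$ elements); $\theta_1(J(n,k))=(k-1)(n-k-1)-1$ is its second largest eigenvalue. NZI means all entries nonzero integers; $m(1,J(n,k))=\min\{\|v\|_\infty+1: v\text{ an NZI }\theta_1(J(n,k))\text{ -eigenvector of }J(n,k)\}$. -}

module Defs where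

open import Data.Nat as ℕ using (ℕ; zero; suc; _⊔_)
open import Data.Integer as ℤ using (ℤ; +_; _-_; _*_; ∣_∣)
open import Data.List using (List; []; _∷_; _++_; map; filter; foldr)
open import Data.Vec using (Vec; []; _∷_)
open import Data.Fin.Subset using (Subset; inside; outside; _∩_) renaming (∣_∣ to card)
open import Data.Product using (Σ; _×_)
open import Relation.Binary.PropositionalEquality using (_≡_; _≢_)

allSubsets : (n : ℕ) → List (Subset n)
allSubsets zero = [] ∷ []
allSubsets (suc n) = map (inside ∷_) (allSubsets n) ++ map (outside ∷_) (allSubsets n)

kSubsets : (n k : ℕ) → List (Subset n)
kSubsets n k = filter (λ S → card S ℕ.≟ k) (allSubsets n)

neighbours : (n k : ℕ) → Subset n → List (Subset n)
neighbours n k S = filter (λ T → card (S ∩ T) ℕ.≟ k ℕ.∸ 1) (kSubsets n k)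

sumℤ : List ℤ → ℤ
sumℤ = foldr ℤ._+_ (+ 0)

θ₁ : ℕ → ℕ → ℤ
θ₁ n k = (+ k - + 1) * (+ n - + k - + 1) - + 1

-- A real vector indexed by vertices of J(n,k) with integer entries:
-- a function on subsets (only its values on k-subsets matter).
-- v is an eigenvector of J(n,k) (adjacency matrix A) for eigenvalue θ:
-- (A v)(S) = θ v(S) for every vertex S, and v ≠ 0.
IsEigenvector : (n k : ℕ) → ℤ → (Subset n → ℤ) → Set
IsEigenvector n k θ v =
  ((S : Subset n) → card S ≡ k → sumℤ (map v (neighbours n k S)) ≡ θ * v S)
  × Σ (Subset n) (λ S → card S ≡ k × v S ≢ + 0)

IsNZI : (n k : ℕ) → (Subset n → ℤ) → Set
IsNZI n k v = (S : Subset n) → card S ≡ k → v S ≢ + 0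

supNorm : (n k : ℕ) → (Subset n → ℤ) → ℕ
supNorm n k v = foldr _⊔_ 0 (map (λ S → ∣ v S ∣) (kSubsets n k))

-- "m(1, J(n,k)) ≤ B": m is the minimum of ‖v‖_∞ + 1 over NZI
-- θ₁-eigenvectors v; the minimum of a set of naturals is ≤ B iff
-- some element of the set is ≤ B.
m1J≤ : (n k B : ℕ) → Set
m1J≤ n k B = Σ (Subset n → ℤ) λ v →
  IsNZI n k v × IsEigenvector n k (θ₁ n k) v × supNorm n k v ℕ.+ 1 ℕ.≤ B

-- If w ∈ ℤⁿ has coordinate sum 0, then v(S) = Σ_{i∈S} w_i is a θ₁-eigenvector of J(n,k):
-- the neighbours of S are S − i + j with i ∈ S, j ∉ S, so Σ_T v(T) = (k−1)(n−k) v(S) + k v(∁S)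
-- = θ₁ v(S), as v(∁S) = −v(S). It remains to choose w with all k-subset sums nonzero and small. With c = ⌊γ/2⌋+1
-- take entries c and c − γ: a k-subset sum is kc − tγ with 0 ≤ t ≤ k, nonzero because γ ∤ kc
-- and of size at most kc because γ ≤ 2c. If γ ∣ n, the number of entries c − γ can be chosen to
-- make the total vanish; otherwise one extra coordinate absorbs the total, and choosing the number
-- y of entries c − γ with yγ < (n−k)c ≤ (y+1)γ keeps the sums through it nonzero and of size at
-- most kγ ≤ c(2k−1).
module Submission where

open import Defs

module WeightEigenvectors where
  open import Data.Bool using (Bool; true; false; if_then_else_; _∧_; T)
  open import Data.Unit using (tt)
  open import Data.Bool.Properties using (∧-zeroʳ)
  open import Data.Integer using (ℤ; +_; _+_; _*_; _-_)
  import Data.Integer.Properties as ℤ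
  open import Data.Integer.Tactic.RingSolver using (solve-∀)
  open import Data.Nat as ℕ using (ℕ; zero; suc; _≡ᵇ_; _∸_)
  open import Data.Product using (_,_)
  import Data.Nat.Properties as ℕ
  open import Data.List using (List; []; _∷_; _++_; map; filter)
  open import Data.List.Properties using (map-∘)
  open import Data.Vec using (Vec; []; _∷_)
  open import Data.Fin.Subset using (Subset; inside; outside; _∩_; ∁; ⊤) renaming (∣_∣ to card)
  open import Data.Fin.Subset.Properties using (∣∁p∣≡n∸∣p∣)
  open import Relation.Binary.PropositionalEquality
  open import Relation.Nullary using (does)
  open import Relation.Unary using (Decidable)
  open ≡-Reasoning

  weight : ∀ {n} → Vec ℤ n → Subset n → ℤ
  weight [] [] = + 0
  weight (x ∷ w) (inside ∷ S) = x + weight w S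
  weight (x ∷ w) (outside ∷ S) = weight w S

  weight-card≡0 : ∀ {n} (w : Vec ℤ n) (S : Subset n) → card S ≡ 0 → weight w S ≡ + 0
  weight-card≡0 [] [] _ = refl
  weight-card≡0 (x ∷ w) (outside ∷ S) e = weight-card≡0 w S e

  weight-∁ : ∀ {n} (w : Vec ℤ n) (S : Subset n) → weight w S + weight w (∁ S) ≡ weight w ⊤
  weight-∁ [] [] = refl
  weight-∁ (x ∷ w) (inside ∷ S) = trans (ℤ.+-assoc x _ _) (cong (_+_ x) (weight-∁ w S))
  weight-∁ (x ∷ w) (outside ∷ S) = trans (swap (weight w S) x _) (cong (_+_ x) (weight-∁ w S))
    where
    swap : ∀ a b c → a + (b + c) ≡ b + (a + c)
    swap = solve-∀

  choose : ℕ → ℕ → ℤ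
  choose _ zero = + 1
  choose zero (suc _) = + 0
  choose (suc s) (suc b) = choose s b + choose s (suc b)

  -- The number of b-subsets of an s-set that contain a given point.
  choose∋ : ℕ → ℕ → ℤ
  choose∋ _ zero = + 0
  choose∋ zero (suc _) = + 0
  choose∋ (suc s) (suc b) = choose s b

  choose-1 : ∀ m → choose m 1 ≡ + m
  choose-1 zero = refl
  choose-1 (suc m) = cong (_+_ (+ 1)) (choose-1 m)

  choose-> : ∀ m j → m ℕ.< j → choose m j ≡ + 0
  choose-> zero (suc j) _ = refl
  choose-> (suc m) (suc j) (ℕ.s≤s m<j) =
    cong₂ _+_ (choose-> m j m<j) (choose-> m (suc j) (ℕ.m≤n⇒m≤1+n m<j))

  choose-diag : ∀ m → choose m m ≡ + 1
  choose-diag zero = refl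
  choose-diag (suc m) = cong₂ _+_ (choose-diag m) (choose-> m (suc m) ℕ.≤-refl)

  choose-suc-pred : ∀ m → choose (suc m) m ≡ + suc m
  choose-suc-pred zero = refl
  choose-suc-pred (suc m) =
    trans (cong₂ _+_ (choose-suc-pred m) (choose-diag (suc m))) (cong +_ (ℕ.+-comm (suc m) 1))

  choose∋-suc-pred : ∀ m → choose∋ (suc m) m ≡ + m
  choose∋-suc-pred zero = refl
  choose∋-suc-pred (suc m) = choose-suc-pred m

  choose∋-pascal : ∀ s b → choose∋ (suc s) b + choose∋ (suc s) (suc b) ≡ choose (suc s) b
  choose∋-pascal s zero = refl
  choose∋-pascal s (suc b) = refl

  weight-choose∋-pascal : ∀ {n} (w : Vec ℤ n) (S : Subset n) b →
    weight w S * (choose∋ (card S) b + choose∋ (card S) (suc b)) ≡ weight w S * choose (card S) b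
  weight-choose∋-pascal w S b with card S in eq
  ... | zero rewrite weight-card≡0 w S eq = trans (ℤ.*-zeroˡ (+ 0 + + 0)) (sym (ℤ.*-zeroˡ (choose 0 b)))
  ... | suc s = cong (weight w S *_) (choose∋-pascal s b)

  module _ {A : Set} where
    ∑ : List A → (A → ℤ) → ℤ
    ∑ xs f = sumℤ (map f xs)

    syntax ∑ xs (λ x → e) = ∑[ x ∈ xs ] e

    ∑-cong : ∀ xs {f g : A → ℤ} → (∀ x → f x ≡ g x) → ∑ xs f ≡ ∑ xs g
    ∑-cong [] f≗g = refl
    ∑-cong (x ∷ xs) f≗g = cong₂ _+_ (f≗g x) (∑-cong xs f≗g)

    ∑-zero : ∀ xs {f : A → ℤ} → (∀ x → f x ≡ + 0) → ∑ xs f ≡ + 0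
    ∑-zero [] f≗0 = refl
    ∑-zero (x ∷ xs) f≗0 = cong₂ _+_ (f≗0 x) (∑-zero xs f≗0)

    ∑-+ : ∀ xs (f g : A → ℤ) → ∑[ x ∈ xs ] (f x + g x) ≡ ∑ xs f + ∑ xs g
    ∑-+ [] f g = refl
    ∑-+ (x ∷ xs) f g = trans (cong (_+_ (f x + g x)) (∑-+ xs f g)) (interchange (f x) (g x) _ _)
      where
      interchange : ∀ a b c d → (a + b) + (c + d) ≡ (a + c) + (b + d)
      interchange = solve-∀

    ∑-*ˡ : ∀ xs (a : ℤ) (f : A → ℤ) → ∑[ x ∈ xs ] (a * f x) ≡ a * ∑ xs f
    ∑-*ˡ [] a f = sym (ℤ.*-zeroʳ a)
    ∑-*ˡ (x ∷ xs) a f =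
      trans (cong (_+_ (a * f x)) (∑-*ˡ xs a f)) (sym (ℤ.*-distribˡ-+ a (f x) (∑ xs f)))

    ∑-++ : ∀ xs ys (f : A → ℤ) → ∑ (xs ++ ys) f ≡ ∑ xs f + ∑ ys f
    ∑-++ [] ys f = sym (ℤ.+-identityˡ _)
    ∑-++ (x ∷ xs) ys f = trans (cong (_+_ (f x)) (∑-++ xs ys f)) (sym (ℤ.+-assoc (f x) _ _))

    ∑-filter : ∀ {P : A → Set} (P? : Decidable P) xs (f : A → ℤ) →
      ∑ (filter P? xs) f ≡ ∑[ x ∈ xs ] (if does (P? x) then f x else + 0)
    ∑-filter P? [] f = refl
    ∑-filter P? (x ∷ xs) f with does (P? x)
    ... | true = cong (_+_ (f x)) (∑-filter P? xs f)
    ... | false = trans (∑-filter P? xs f) (sym (ℤ.+-identityˡ _))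

  ∑-map : ∀ {A B : Set} xs (g : A → B) (f : B → ℤ) → ∑ (map g xs) f ≡ ∑[ x ∈ xs ] f (g x)
  ∑-map xs g f = cong sumℤ (sym (map-∘ xs))

  ∑ₛ : (n : ℕ) → (Subset n → ℤ) → ℤ
  ∑ₛ n = ∑ (allSubsets n)

  ∑ₛ-suc : ∀ n (f : Subset (suc n) → ℤ) →
    ∑ₛ (suc n) f ≡ ∑ₛ n (λ T → f (inside ∷ T)) + ∑ₛ n (λ T → f (outside ∷ T))
  ∑ₛ-suc n f = trans (∑-++ (map (inside ∷_) (allSubsets n)) _ f)
    (cong₂ _+_ (∑-map (allSubsets n) _ f) (∑-map (allSubsets n) _ f))

  meets : ∀ {n} → Subset n → ℕ → ℕ → Subset n → Bool
  meets S b c T = (card (S ∩ T) ≡ᵇ b) ∧ (card (∁ S ∩ T) ≡ᵇ c)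

  if-+ : ∀ β (x y : ℤ) → (if β then x + y else + 0) ≡ x * (if β then + 1 else + 0) + (if β then y else + 0)
  if-+ true x y = cong (_+ y) (sym (ℤ.*-identityʳ x))
  if-+ false x y = sym (trans (ℤ.+-identityʳ _) (ℤ.*-zeroʳ x))

  count-meets : ∀ {n} (S : Subset n) b c →
    ∑ₛ n (λ T → if meets S b c T then + 1 else + 0) ≡ choose (card S) b * choose (card (∁ S)) c
  count-meets [] zero zero = refl
  count-meets [] zero (suc c) = refl
  count-meets [] (suc b) zero = refl
  count-meets [] (suc b) (suc c) = refl
  count-meets {suc n} (inside ∷ S) zero c = trans (∑ₛ-suc n _)
    (trans (cong₂ _+_ (∑-zero (allSubsets n) (λ _ → refl)) (count-meets S zero c)) (ℤ.+-identityˡ _))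
  count-meets {suc n} (inside ∷ S) (suc b) c = trans (∑ₛ-suc n _)
    (trans (cong₂ _+_ (count-meets S b c) (count-meets S (suc b) c))
      (sym (ℤ.*-distribʳ-+ (choose (card (∁ S)) c) (choose (card S) b) _)))
  count-meets {suc n} (outside ∷ S) b zero = trans (∑ₛ-suc n _)
    (trans (cong₂ _+_ (∑-zero (allSubsets n) inside-vanishes) (count-meets S b zero)) (ℤ.+-identityˡ _))
    where
    inside-vanishes : ∀ T → (if meets (outside ∷ S) b zero (inside ∷ T) then + 1 else + 0) ≡ + 0
    inside-vanishes T rewrite ∧-zeroʳ (card (S ∩ T) ≡ᵇ b) = refl
  count-meets {suc n} (outside ∷ S) b (suc c) = trans (∑ₛ-suc n _)
    (trans (cong₂ _+_ (count-meets S b c) (count-meets S b (suc c)))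
      (sym (ℤ.*-distribˡ-+ (choose (card S) b) (choose (card (∁ S)) c) _)))

  ∑-if-+ : ∀ {A : Set} xs (β : A → Bool) (x : ℤ) (f : A → ℤ) →
    ∑[ T ∈ xs ] (if β T then x + f T else + 0)
      ≡ x * ∑[ T ∈ xs ] (if β T then + 1 else + 0) + ∑[ T ∈ xs ] (if β T then f T else + 0)
  ∑-if-+ xs β x f = trans (∑-cong xs (λ T → if-+ (β T) x (f T)))
    (trans (∑-+ xs _ _) (cong (_+ _) (∑-*ˡ xs x _)))

  weight-meets : ∀ {n} (w : Vec ℤ n) (S : Subset n) b c →
    ∑ₛ n (λ T → if meets S b c T then weight w T else + 0)
      ≡ weight w S * choose∋ (card S) b * choose (card (∁ S)) c
        + weight w (∁ S) * choose (card S) b * choose∋ (card (∁ S)) c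
  weight-meets [] [] zero zero = refl
  weight-meets [] [] zero (suc c) = refl
  weight-meets [] [] (suc b) zero = refl
  weight-meets [] [] (suc b) (suc c) = refl
  weight-meets {suc n} (x ∷ w) (inside ∷ S) zero c = trans (∑ₛ-suc n _)
    (trans (cong₂ _+_ (∑-zero (allSubsets n) (λ _ → refl)) (weight-meets w S zero c))
      (rearrange (weight w S) x (weight w (∁ S)) (choose (card (∁ S)) c) (choose∋ (card (∁ S)) c)))
    where
    rearrange : ∀ W x W' R P → + 0 + (W * + 0 * R + W' * + 1 * P) ≡ (x + W) * + 0 * R + W' * + 1 * P
    rearrange = solve-∀
  weight-meets {suc n} (x ∷ w) (inside ∷ S) (suc b) c = begin
    ∑ₛ (suc n) (λ T → if meets (inside ∷ S) (suc b) c T then weight (x ∷ w) T else + 0)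
      ≡⟨ ∑ₛ-suc n _ ⟩
    ∑ₛ n (λ T → if meets S b c T then x + weight w T else + 0) + G (suc b)
      ≡⟨ cong (_+ G (suc b)) (∑-if-+ (allSubsets n) (meets S b c) x (weight w)) ⟩
    x * ∑ₛ n (λ T → if meets S b c T then + 1 else + 0) + G b + G (suc b)
      ≡⟨ cong₂ _+_ (cong₂ _+_ (cong (x *_) (count-meets S b c)) (weight-meets w S b c))
                   (weight-meets w S (suc b) c) ⟩
    x * (Z * R) + (W * X * R + W' * Z * P) + (W * Y * R + W' * Z' * P)
      ≡⟨ collect x W W' X Y Z Z' R P ⟩
    x * Z * R + W * (X + Y) * R + W' * (Z + Z') * P
      ≡⟨ cong (λ u → x * Z * R + u * R + W' * (Z + Z') * P) (weight-choose∋-pascal w S b) ⟩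
    x * Z * R + W * Z * R + W' * (Z + Z') * P
      ≡⟨ factor x W W' Z Z' R P ⟩
    (x + W) * Z * R + W' * (Z + Z') * P
      ∎
    where
    G : ℕ → ℤ
    G b = ∑ₛ n (λ T → if meets S b c T then weight w T else + 0)
    W = weight w S
    W' = weight w (∁ S)
    X = choose∋ (card S) b
    Y = choose∋ (card S) (suc b)
    Z = choose (card S) b
    Z' = choose (card S) (suc b)
    R = choose (card (∁ S)) c
    P = choose∋ (card (∁ S)) c
    collect : ∀ x W W' X Y Z Z' R P →
      x * (Z * R) + (W * X * R + W' * Z * P) + (W * Y * R + W' * Z' * P)
        ≡ x * Z * R + W * (X + Y) * R + W' * (Z + Z') * P
    collect = solve-∀
    factor : ∀ x W W' Z Z' R P →
      x * Z * R + W * Z * R + W' * (Z + Z') * P ≡ (x + W) * Z * R + W' * (Z + Z') * P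
    factor = solve-∀
  weight-meets {suc n} (x ∷ w) (outside ∷ S) b zero = trans (∑ₛ-suc n _)
    (trans (cong₂ _+_ (∑-zero (allSubsets n) inside-vanishes) (weight-meets w S b zero))
      (rearrange (weight w S) x (weight w (∁ S)) (choose∋ (card S) b) (choose (card S) b)))
    where
    inside-vanishes : ∀ T → (if meets (outside ∷ S) b zero (inside ∷ T) then x + weight w T else + 0) ≡ + 0
    inside-vanishes T rewrite ∧-zeroʳ (card (S ∩ T) ≡ᵇ b) = refl
    rearrange : ∀ W x W' X Z → + 0 + (W * X * + 1 + W' * Z * + 0) ≡ W * X * + 1 + (x + W') * Z * + 0
    rearrange = solve-∀
  weight-meets {suc n} (x ∷ w) (outside ∷ S) b (suc c) = begin
    ∑ₛ (suc n) (λ T → if meets (outside ∷ S) b (suc c) T then weight (x ∷ w) T else + 0)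
      ≡⟨ ∑ₛ-suc n _ ⟩
    ∑ₛ n (λ T → if meets S b c T then x + weight w T else + 0) + G (suc c)
      ≡⟨ cong (_+ G (suc c)) (∑-if-+ (allSubsets n) (meets S b c) x (weight w)) ⟩
    x * ∑ₛ n (λ T → if meets S b c T then + 1 else + 0) + G c + G (suc c)
      ≡⟨ cong₂ _+_ (cong₂ _+_ (cong (x *_) (count-meets S b c)) (weight-meets w S b c))
                   (weight-meets w S b (suc c)) ⟩
    x * (Z * R) + (W * X * R + W' * Z * P) + (W * X * R' + W' * Z * P')
      ≡⟨ collect x W W' X Z R R' P P' ⟩
    x * Z * R + W * X * (R + R') + W' * (P + P') * Z
      ≡⟨ cong (λ u → x * Z * R + W * X * (R + R') + u * Z) (weight-choose∋-pascal w (∁ S) c) ⟩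
    x * Z * R + W * X * (R + R') + W' * R * Z
      ≡⟨ factor x W W' X Z R R' ⟩
    W * X * (R + R') + (x + W') * Z * R
      ∎
    where
    G : ℕ → ℤ
    G c = ∑ₛ n (λ T → if meets S b c T then weight w T else + 0)
    W = weight w S
    W' = weight w (∁ S)
    X = choose∋ (card S) b
    Z = choose (card S) b
    R = choose (card (∁ S)) c
    R' = choose (card (∁ S)) (suc c)
    P = choose∋ (card (∁ S)) c
    P' = choose∋ (card (∁ S)) (suc c)
    collect : ∀ x W W' X Z R R' P P' →
      x * (Z * R) + (W * X * R + W' * Z * P) + (W * X * R' + W' * Z * P')
        ≡ x * Z * R + W * X * (R + R') + W' * (P + P') * Z
    collect = solve-∀
    factor : ∀ x W W' X Z R R' →
      x * Z * R + W * X * (R + R') + W' * R * Z ≡ W * X * (R + R') + (x + W') * Z * R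
    factor = solve-∀

  card-∩-∁ : ∀ {n} (S T : Subset n) → card T ≡ card (S ∩ T) ℕ.+ card (∁ S ∩ T)
  card-∩-∁ [] [] = refl
  card-∩-∁ (inside ∷ S) (inside ∷ T) = cong suc (card-∩-∁ S T)
  card-∩-∁ (inside ∷ S) (outside ∷ T) = card-∩-∁ S T
  card-∩-∁ (outside ∷ S) (inside ∷ T) = trans (cong suc (card-∩-∁ S T)) (sym (ℕ.+-suc _ _))
  card-∩-∁ (outside ∷ S) (outside ∷ T) = card-∩-∁ S T

  +≡ᵇsuc : ∀ k o → (k ℕ.+ o ≡ᵇ suc k) ≡ (o ≡ᵇ 1)
  +≡ᵇsuc zero o = refl
  +≡ᵇsuc (suc k) o = +≡ᵇsuc k o

  if-neighbour : ∀ a o k (x : ℤ) →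
    (if a ℕ.+ o ≡ᵇ suc k then (if a ≡ᵇ k then x else + 0) else + 0)
      ≡ (if (a ≡ᵇ k) ∧ (o ≡ᵇ 1) then x else + 0)
  if-neighbour a o k x with a ≡ᵇ k in eq
  ... | false = if-zero (a ℕ.+ o ≡ᵇ suc k)
    where
    if-zero : ∀ β → (if β then + 0 else + 0) ≡ + 0
    if-zero true = refl
    if-zero false = refl
  ... | true rewrite ℕ.≡ᵇ⇒≡ a k (subst T (sym eq) tt) = cong (λ β → if β then x else + 0) (+≡ᵇsuc k o)

  ∑-neighbours : ∀ n k (S : Subset n) (f : Subset n → ℤ) →
    ∑ (neighbours n (suc k) S) f ≡ ∑ₛ n (λ T → if meets S k 1 T then f T else + 0)
  ∑-neighbours n k S f = begin
    ∑ (neighbours n (suc k) S) f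
      ≡⟨ ∑-filter (λ T → card (S ∩ T) ℕ.≟ k) (kSubsets n (suc k)) f ⟩
    ∑[ T ∈ kSubsets n (suc k) ] (if card (S ∩ T) ≡ᵇ k then f T else + 0)
      ≡⟨ ∑-filter (λ T → card T ℕ.≟ suc k) (allSubsets n) _ ⟩
    ∑ₛ n (λ T → if card T ≡ᵇ suc k then (if card (S ∩ T) ≡ᵇ k then f T else + 0) else + 0)
      ≡⟨ ∑-cong (allSubsets n) (λ T → trans
           (cong (λ m → if m ≡ᵇ suc k then (if card (S ∩ T) ≡ᵇ k then f T else + 0) else + 0)
                 (card-∩-∁ S T))
           (if-neighbour (card (S ∩ T)) (card (∁ S ∩ T)) k (f T))) ⟩
    ∑ₛ n (λ T → if meets S k 1 T then f T else + 0)
      ∎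

  θ₁-closed-form : ∀ W W' k r → W + W' ≡ + 0 →
    W * choose∋ (suc k) k * choose (suc r) 1 + W' * choose (suc k) k * choose∋ (suc r) 1
      ≡ θ₁ (suc k ℕ.+ suc r) (suc k) * W
  θ₁-closed-form W W' k r W+W'≡0
    rewrite choose∋-suc-pred k | choose-suc-pred k | choose-1 r = begin
      W * + k * (+ 1 + + r) + W' * (+ 1 + + k) * + 1
        ≡⟨ regroup W W' (+ k) (+ r) ⟩
      (W + W') * (+ 1 + + k) + W * (+ k * + r - + 1)
        ≡⟨ cong (λ u → u * (+ 1 + + k) + W * (+ k * + r - + 1)) W+W'≡0 ⟩
      + 0 * (+ 1 + + k) + W * (+ k * + r - + 1)
        ≡⟨ expand W (+ k) (+ r) ⟩
      θ₁ (suc k ℕ.+ suc r) (suc k) * W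
        ∎
    where
    regroup : ∀ W W' k r →
      W * k * (+ 1 + r) + W' * (+ 1 + k) * + 1 ≡ (W + W') * (+ 1 + k) + W * (k * r - + 1)
    regroup = solve-∀
    expand : ∀ W k r →
      + 0 * (+ 1 + k) + W * (k * r - + 1)
        ≡ (((+ 1 + k) - + 1) * ((+ 1 + k) + (+ 1 + r) - (+ 1 + k) - + 1) - + 1) * W
    expand = solve-∀

  weight-eigen : ∀ n k (w : Vec ℤ n) → weight w ⊤ ≡ + 0 → 1 ℕ.≤ k → k ℕ.< n →
    ∀ S → card S ≡ k → ∑ (neighbours n k S) (weight w) ≡ θ₁ n k * weight w S
  weight-eigen n zero w total≡0 () k<n S ∣S∣≡k
  weight-eigen n (suc k) w total≡0 _ k<n S ∣S∣≡k with ℕ.m≤n⇒∃[o]m+o≡n k<n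
  ... | r , refl = begin
    ∑ (neighbours n (suc k) S) (weight w)
      ≡⟨ ∑-neighbours n k S (weight w) ⟩
    ∑ₛ n (λ T → if meets S k 1 T then weight w T else + 0)
      ≡⟨ weight-meets w S k 1 ⟩
    W * choose∋ (card S) k * choose (card (∁ S)) 1 + W' * choose (card S) k * choose∋ (card (∁ S)) 1
      ≡⟨ cong₂ (λ s t → W * choose∋ s k * choose t 1 + W' * choose s k * choose∋ t 1) ∣S∣≡k ∣∁S∣≡1+r ⟩
    W * choose∋ (suc k) k * choose (suc r) 1 + W' * choose (suc k) k * choose∋ (suc r) 1
      ≡⟨ θ₁-closed-form W W' k r (trans (weight-∁ w S) total≡0) ⟩
    θ₁ (suc k ℕ.+ suc r) (suc k) * W
      ≡⟨ cong (λ m → θ₁ m (suc k) * W) (ℕ.+-suc (suc k) r) ⟩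
    θ₁ n (suc k) * W
      ∎
    where
    W = weight w S
    W' = weight w (∁ S)
    ∣∁S∣≡1+r : card (∁ S) ≡ suc r
    ∣∁S∣≡1+r = begin
      card (∁ S)                  ≡⟨ ∣∁p∣≡n∸∣p∣ S ⟩
      n ∸ card S                  ≡⟨ cong (n ∸_) ∣S∣≡k ⟩
      n ∸ suc k                   ≡⟨ cong (_∸ suc k) (ℕ.+-suc (suc k) r) ⟨
      (suc k ℕ.+ suc r) ∸ suc k   ≡⟨ ℕ.m+n∸m≡n (suc k) (suc r) ⟩
      suc r                       ∎

module Construction where
  open import Data.Nat
  open import Data.Nat.Properties
  open import Data.Nat.DivMod using (_/_; _%_; m≡m%n+[m/n]*n; m%n<n; m/n*n≤m)
  open import Data.Nat.Divisibility using (_∣_; divides)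
  open import Data.Integer as ℤ using (ℤ; +_; ∣_∣)
  import Data.Integer.Properties as ℤ
  open import Data.Integer.Tactic.RingSolver using (solve-∀)
  import Data.Nat.Tactic.RingSolver as ℕ-Ring
  open import Data.List using (List; []; _∷_; foldr; map)
  open import Data.List.Relation.Unary.All as All using (All; []; _∷_)
  open import Data.List.Relation.Unary.All.Properties using (all-filter; map⁺)
  open import Data.Vec using (Vec; []; _∷_)
  open import Data.Fin.Subset using (Subset; inside; outside; ⊥; ⊤) renaming (∣_∣ to card)
  open import Data.Fin.Subset.Properties using (∣⊥∣≡0)
  open import Data.Product using (Σ; ∃; _×_; _,_; proj₁; proj₂)
  open import Relation.Binary.PropositionalEquality
  open import Relation.Nullary using (¬_; yes; no)
  open WeightEigenvectors using (weight; weight-eigen)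

  ∃-subset : ∀ {n k} → k ≤ n → ∃ λ (S : Subset n) → card S ≡ k
  ∃-subset {n} {zero} _ = ⊥ , ∣⊥∣≡0 n
  ∃-subset {suc n} {suc k} (s≤s k≤n) with ∃-subset k≤n
  ... | S , ∣S∣≡k = inside ∷ S , cong suc ∣S∣≡k

  foldr-⊔-≤ : ∀ {B} {xs : List ℕ} → All (_≤ B) xs → foldr _⊔_ 0 xs ≤ B
  foldr-⊔-≤ [] = z≤n
  foldr-⊔-≤ (x≤B ∷ xs≤B) = ⊔-lub x≤B (foldr-⊔-≤ xs≤B)

  supNorm≤ : ∀ n k (v : Subset n → ℤ) B → (∀ S → card S ≡ k → ∣ v S ∣ ≤ B) → supNorm n k v ≤ B
  supNorm≤ n k v B bound =
    foldr-⊔-≤ (map⁺ (All.map (λ {S} → bound S) (all-filter (λ S → card S ≟ k) (allSubsets n))))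

  m1J≤-weight : ∀ n k (w : Vec ℤ n) B → 1 ≤ k → k < n → weight w ⊤ ≡ + 0 →
    (∀ S → card S ≡ k → weight w S ≢ + 0 × ∣ weight w S ∣ ≤ B) → m1J≤ n k (B + 1)
  m1J≤-weight n k w B 1≤k k<n total≡0 entries with ∃-subset (<⇒≤ k<n)
  ... | S , ∣S∣≡k =
    weight w , (λ S e → proj₁ (entries S e)) ,
    (weight-eigen n k w total≡0 1≤k k<n , S , ∣S∣≡k , proj₁ (entries S ∣S∣≡k)) ,
    +-monoˡ-≤ 1 (supNorm≤ n k (weight w) B (λ S e → proj₂ (entries S e)))

  m1J≤-mono : ∀ {n k B B′} → m1J≤ n k B → B ≤ B′ → m1J≤ n k B′
  m1J≤-mono (v , nzi , eigen , ‖v‖+1≤B) B≤B′ = v , nzi , eigen , ≤-trans ‖v‖+1≤B B≤B′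

  [+m]-[+n]≢0 : ∀ {m n} → m ≢ n → + m ℤ.- + n ≢ + 0
  [+m]-[+n]≢0 m≢n e = m≢n (ℤ.+-injective (ℤ.i-j≡0⇒i≡j _ _ e))

  ∣[+m]-[+n]∣≤ : ∀ {m n B} → m ≤ n + B → n ≤ m + B → ∣ + m ℤ.- + n ∣ ≤ B
  ∣[+m]-[+n]∣≤ {m} {n} {B} m≤n+B n≤m+B rewrite ℤ.[+m]-[+n]≡m⊖n m n with m ≤? n
  ... | yes m≤n rewrite ℤ.∣⊖∣-≤ m≤n = ≤-trans (∸-monoˡ-≤ m n≤m+B) (≤-reflexive (m+n∸m≡n m B))
  ... | no m≰n rewrite ℤ.⊖-≥ (≰⇒≥ m≰n) = ≤-trans (∸-monoˡ-≤ n m≤n+B) (≤-reflexive (m+n∸m≡n n B))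

  admissible-difference : ∀ {m n B} → m ≢ n → m ≤ n + B → n ≤ m + B →
    + m ℤ.- + n ≢ + 0 × ∣ + m ℤ.- + n ∣ ≤ B
  admissible-difference m≢n m≤n+B n≤m+B = [+m]-[+n]≢0 m≢n , ∣[+m]-[+n]∣≤ m≤n+B n≤m+B

  ∃-bracketing-multiple : ∀ q n .⦃ _ : NonZero n ⦄ → 1 ≤ q → ∃ λ y → y * n < q × q ≤ y * n + n
  ∃-bracketing-multiple (suc p) n _ = p / n , s≤s (m/n*n≤m p n) , (begin
    suc p                   ≡⟨ cong suc (m≡m%n+[m/n]*n p n) ⟩
    suc (p % n + p / n * n) ≤⟨ +-monoˡ-≤ (p / n * n) (m%n<n p n) ⟩
    n + p / n * n           ≡⟨ +-comm n (p / n * n) ⟩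
    p / n * n + n           ∎)
    where open ≤-Reasoning

  module Shifted (c γ : ℕ) where

    shifted : (m y : ℕ) → Vec ℤ m
    shifted zero _ = []
    shifted (suc m) zero = + c ∷ shifted m zero
    shifted (suc m) (suc y) = (+ c ℤ.- + γ) ∷ shifted m y

    add-entry : ∀ x a b → x ℤ.+ (a ℤ.- b) ≡ (x ℤ.+ a) ℤ.- b
    add-entry = solve-∀

    add-shifted-entry : ∀ x g a b → (x ℤ.- g) ℤ.+ (a ℤ.- b) ≡ (x ℤ.+ a) ℤ.- (g ℤ.+ b)
    add-shifted-entry = solve-∀

    weight-shifted : ∀ {m} y (S : Subset m) →
      Σ ℕ λ t → t ≤ card S × weight (shifted m y) S ≡ + (card S * c) ℤ.- + (t * γ)
    weight-shifted y [] = 0 , z≤n , refl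
    weight-shifted zero (outside ∷ S) = weight-shifted zero S
    weight-shifted zero (inside ∷ S) with weight-shifted zero S
    ... | t , t≤∣S∣ , eq = t , m≤n⇒m≤1+n t≤∣S∣ ,
      trans (cong (ℤ._+_ (+ c)) eq) (add-entry (+ c) (+ (card S * c)) (+ (t * γ)))
    weight-shifted (suc y) (outside ∷ S) = weight-shifted y S
    weight-shifted (suc y) (inside ∷ S) with weight-shifted y S
    ... | t , t≤∣S∣ , eq = suc t , s≤s t≤∣S∣ ,
      trans (cong (ℤ._+_ (+ c ℤ.- + γ)) eq) (add-shifted-entry (+ c) (+ γ) (+ (card S * c)) (+ (t * γ)))

    total-shifted : ∀ m y → y ≤ m → weight (shifted m y) ⊤ ≡ + (m * c) ℤ.- + (y * γ)
    total-shifted zero zero _ = refl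
    total-shifted (suc m) zero _ =
      trans (cong (ℤ._+_ (+ c)) (total-shifted m zero z≤n)) (add-entry (+ c) (+ (m * c)) (+ 0))
    total-shifted (suc m) (suc y) (s≤s y≤m) =
      trans (cong (ℤ._+_ (+ c ℤ.- + γ)) (total-shifted m y y≤m))
        (add-shifted-entry (+ c) (+ γ) (+ (m * c)) (+ (y * γ)))

    γ∣n⇒m1J≤[k*c+1] : ∀ {n k} → c ≤ γ → γ ≤ c + c → ¬ γ ∣ k * c → γ ∣ n → 1 ≤ k → k < n →
      m1J≤ n k (k * c + 1)
    γ∣n⇒m1J≤[k*c+1] {n} {k} c≤γ γ≤2c γ∤kc (divides d n≡dγ) 1≤k k<n =
      m1J≤-weight n k (shifted n y) (k * c) 1≤k k<n total≡0 entries
      where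
      y = d * c
      nc≡yγ : n * c ≡ y * γ
      nc≡yγ = trans (cong (_* c) n≡dγ) (swap d γ c)
        where
        swap : ∀ d γ c → d * γ * c ≡ d * c * γ
        swap = ℕ-Ring.solve-∀
      total≡0 : weight (shifted n y) ⊤ ≡ + 0
      total≡0 = trans (total-shifted n y (subst (y ≤_) (sym n≡dγ) (*-monoʳ-≤ d c≤γ)))
                      (ℤ.i≡j⇒i-j≡0 (cong +_ nc≡yγ))
      entries : ∀ S → card S ≡ k → weight (shifted n y) S ≢ + 0 × ∣ weight (shifted n y) S ∣ ≤ k * c
      entries S ∣S∣≡k with weight-shifted y S
      ... | t , t≤∣S∣ , eq rewrite eq | ∣S∣≡k =
        admissible-difference (λ kc≡tγ → γ∤kc (divides t kc≡tγ)) (m≤n+m (k * c) (t * γ)) tγ≤kc+kc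
        where
        tγ≤kc+kc : t * γ ≤ k * c + k * c
        tγ≤kc+kc = ≤-trans (*-mono-≤ t≤∣S∣ γ≤2c) (≤-reflexive (*-distribˡ-+ k c c))

    m1J≤-bracketed : ∀ {m k} y → c ≤ γ → ¬ γ ∣ suc k * c → k < m →
      y * γ < (m ∸ k) * c → (m ∸ k) * c ≤ y * γ + γ → m1J≤ (suc m) (suc k) (suc k * γ + 1)
    m1J≤-bracketed {m} {k} y c≤γ γ∤Kc k<m yγ<q q≤yγ+γ =
      m1J≤-weight (suc m) (suc k) w (suc k * γ) (s≤s z≤n) (s≤s k<m) total≡0 entries
      where
      q = (m ∸ k) * c
      w = (+ (y * γ) ℤ.- + (m * c)) ∷ shifted m y
      y≤m : y ≤ m
      y≤m = <⇒≤ (*-cancelʳ-< γ y m (<-≤-trans yγ<q (*-mono-≤ (m∸n≤m m k) c≤γ)))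
      total≡0 : weight w ⊤ ≡ + 0
      total≡0 rewrite total-shifted m y y≤m = cancel (+ (y * γ)) (+ (m * c))
        where
        cancel : ∀ a b → (a ℤ.- b) ℤ.+ (b ℤ.- a) ≡ + 0
        cancel = solve-∀
      mc≡q+kc : m * c ≡ q + k * c
      mc≡q+kc = trans (cong (_* c) (sym (m∸n+n≡m (<⇒≤ k<m)))) (*-distribʳ-+ c (m ∸ k) k)
      weight-inside : ∀ t → (+ (y * γ) ℤ.- + (m * c)) ℤ.+ (+ (k * c) ℤ.- + (t * γ)) ≡ + (y * γ) ℤ.- + (q + t * γ)
      weight-inside t rewrite mc≡q+kc = regroup (+ (y * γ)) (+ q) (+ (k * c)) (+ (t * γ))
        where
        regroup : ∀ Y Q K T → (Y ℤ.- (Q ℤ.+ K)) ℤ.+ (K ℤ.- T) ≡ Y ℤ.- (Q ℤ.+ T)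
        regroup = solve-∀
      entries : ∀ S → card S ≡ suc k → weight w S ≢ + 0 × ∣ weight w S ∣ ≤ suc k * γ
      entries (outside ∷ S) ∣S∣≡K with weight-shifted y S
      ... | t , t≤∣S∣ , eq rewrite eq | ∣S∣≡K =
        admissible-difference (λ Kc≡tγ → γ∤Kc (divides t Kc≡tγ))
          (≤-trans (*-monoʳ-≤ (suc k) c≤γ) (m≤n+m (suc k * γ) (t * γ)))
          (≤-trans (*-monoˡ-≤ γ t≤∣S∣) (m≤n+m (suc k * γ) (suc k * c)))
      entries (inside ∷ S) ∣S∣≡K with weight-shifted y S
      ... | t , t≤∣S∣ , eq rewrite eq | suc-injective ∣S∣≡K | weight-inside t =
        admissible-difference (<⇒≢ (<-≤-trans yγ<q (m≤m+n q (t * γ))))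
          (≤-trans (<⇒≤ yγ<q) (≤-trans (m≤m+n q (t * γ)) (m≤m+n _ _)))
          (≤-trans (+-mono-≤ q≤yγ+γ (*-monoˡ-≤ γ t≤∣S∣)) (≤-reflexive (+-assoc (y * γ) γ (k * γ))))

    m1J≤[k*γ+1] : ∀ {n k} .⦃ _ : NonZero γ ⦄ → c ≤ γ → 1 ≤ c → ¬ γ ∣ k * c → 1 ≤ k → k < n →
      m1J≤ n k (k * γ + 1)
    m1J≤[k*γ+1] {suc m} {suc k} c≤γ 1≤c γ∤Kc _ (s≤s k<m)
      with ∃-bracketing-multiple ((m ∸ k) * c) γ (*-mono-≤ (m<n⇒0<n∸m k<m) 1≤c)
    ... | y , yγ<q , q≤yγ+γ = m1J≤-bracketed y c≤γ γ∤Kc k<m yγ<q q≤yγ+γ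

module Multipliers where
  open import Data.Nat
  open import Data.Nat.Properties
  open import Data.Nat.DivMod using (_/_; _%_; m≡m%n+[m/n]*n; m%n<n)
  open import Data.Nat.Divisibility
  open import Data.Nat.Primality using (euclidsLemma; prime[2])
  open import Data.Nat.Tactic.RingSolver using (solve-∀)
  open import Data.Sum using (_⊎_; inj₁; inj₂)
  open import Data.Empty using (⊥-elim)
  open import Relation.Binary.PropositionalEquality
  open import Relation.Nullary using (¬_)

  record Multiplier (k γ c : ℕ) : Set where
    field
      c<γ : c < γ
      γ<c+c : γ < c + c
      c≤k : c ≤ k
      γ∤k*c : ¬ γ ∣ k * c

  n≡[n/2]*2⊎n≡1+[n/2]*2 : ∀ n → n ≡ n / 2 * 2 ⊎ n ≡ suc (n / 2 * 2)
  n≡[n/2]*2⊎n≡1+[n/2]*2 n with n % 2 | m≡m%n+[m/n]*n n 2 | m%n<n n 2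
  ... | 0 | n≡ | _ = inj₁ n≡
  ... | 1 | n≡ | _ = inj₂ n≡
  ... | suc (suc _) | _ | s≤s (s≤s ())

  module _ {k γ : ℕ} (1≤k : 1 ≤ k) (divisors : ∀ d → 1 ≤ d → d < γ → d ∣ k) where
    private instance
      k≢0 : NonZero k
      k≢0 = >-nonZero 1≤k

    multiplier-odd : ∀ h → γ ≡ suc (h * 2) → 1 ≤ h → ¬ γ ∣ k → Multiplier k γ (h + 1)
    multiplier-odd h refl 1≤h γ∤k = record
      { c<γ = c<γ
      ; γ<c+c = ≤-reflexive (sym (c+c≡2+h*2 h))
      ; c≤k = ∣⇒≤ c∣k
      ; γ∤k*c = λ γ∣kc → γ∤k (∣m+n∣m⇒∣n (subst (γ ∣_) (2kc≡kγ+k k h) (∣m⇒∣m*n 2 γ∣kc)) (n∣m*n k))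
      }
      where
      h+h≡h*2 : ∀ h → h + h ≡ h * 2
      h+h≡h*2 = solve-∀
      c+c≡2+h*2 : ∀ h → (h + 1) + (h + 1) ≡ suc (suc (h * 2))
      c+c≡2+h*2 = solve-∀
      2kc≡kγ+k : ∀ k h → k * (h + 1) * 2 ≡ k * suc (h * 2) + k
      2kc≡kγ+k = solve-∀
      c<γ : h + 1 < γ
      c<γ = s≤s (≤-trans (+-monoʳ-≤ h 1≤h) (≤-reflexive (h+h≡h*2 h)))
      c∣k : h + 1 ∣ k
      c∣k = divisors (h + 1) (m≤n+m 1 h) c<γ

    multiplier-even : ∀ h → γ ≡ h * 2 → 2 ≤ h → 2 ∣ k → ¬ γ ∣ k → Multiplier k γ (h + 1)
    multiplier-even h refl 2≤h 2∣k γ∤k = record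
      { c<γ = c<γ
      ; γ<c+c = ≤-trans (n≤1+n _) (≤-reflexive (sym (c+c≡2+h*2 h)))
      ; c≤k = ∣⇒≤ (divisors (h + 1) (m≤n+m 1 h) c<γ)
      ; γ∤k*c = γ∤k*c
      }
      where
      instance
        _ : NonZero h
        _ = >-nonZero (≤-trans (s≤s z≤n) 2≤h)
      h+h≡h*2 : ∀ h → h + h ≡ h * 2
      h+h≡h*2 = solve-∀
      c+c≡2+h*2 : ∀ h → (h + 1) + (h + 1) ≡ suc (suc (h * 2))
      c+c≡2+h*2 = solve-∀
      c<γ : h + 1 < h * 2
      c<γ = ≤-trans (≤-reflexive (1+c≡h+2 h)) (≤-trans (+-monoʳ-≤ h 2≤h) (≤-reflexive (h+h≡h*2 h)))
        where
        1+c≡h+2 : ∀ h → suc (h + 1) ≡ h + 2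
        1+c≡h+2 = solve-∀
      h<γ : h < h * 2
      h<γ = ≤-trans (m≤m+n (suc h) 1) c<γ
      -- With k = t h, γ ∣ k(h+1) gives 2 ∣ t(h+1); as k is even also 2 ∣ t h, so 2 ∣ t and γ ∣ k.
      γ∤k*c : ¬ h * 2 ∣ k * (h + 1)
      γ∤k*c γ∣kc with divisors h (≤-trans (s≤s z≤n) 2≤h) h<γ
      ... | divides t refl = γ∤k (subst (_∣ t * h) (*-comm 2 h) (*-monoˡ-∣ h 2∣t))
        where
        regroup : ∀ t h → t * h * (h + 1) ≡ h * (t * (h + 1))
        regroup = solve-∀
        2∣t[h+1] : 2 ∣ t * (h + 1)
        2∣t[h+1] = *-cancelˡ-∣ h (subst (h * 2 ∣_) (regroup t h) γ∣kc)
        2∤h+1 : 2 ∣ h → ¬ 2 ∣ h + 1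
        2∤h+1 2∣h 2∣h+1 with ∣1⇒≡1 (∣m+n∣m⇒∣n 2∣h+1 2∣h)
        ... | ()
        2∣t : 2 ∣ t
        2∣t with euclidsLemma t (h + 1) prime[2] 2∣t[h+1]
        ... | inj₁ 2∣t = 2∣t
        ... | inj₂ 2∣h+1 with euclidsLemma t h prime[2] 2∣k
        ...   | inj₁ 2∣t = 2∣t
        ...   | inj₂ 2∣h = ⊥-elim (2∤h+1 2∣h 2∣h+1)

    multiplier : 3 ≤ γ → 2 ∣ k → ¬ γ ∣ k → Multiplier k γ (γ / 2 + 1)
    multiplier 3≤γ 2∣k γ∤k with n≡[n/2]*2⊎n≡1+[n/2]*2 γ
    ... | inj₁ γ≡2h = multiplier-even (γ / 2) γ≡2h
            (*-cancelʳ-< 2 1 (γ / 2) (≤-trans 3≤γ (≤-reflexive γ≡2h))) 2∣k γ∤k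
    ... | inj₂ γ≡2h+1 = multiplier-odd (γ / 2) γ≡2h+1
            (*-cancelʳ-< 2 0 (γ / 2) (≤-pred (≤-trans (n≤1+n 2) (≤-trans 3≤γ (≤-reflexive γ≡2h+1))))) γ∤k

  k*γ≤c*[2k+b∸1] : ∀ {k γ c} b → γ < c + c → c ≤ k → k * γ ≤ c * (2 * k + b ∸ 1)
  k*γ≤c*[2k+b∸1] {k} {γ} {c} b γ<c+c c≤k = begin
    k * γ                 ≤⟨ m+n≤o⇒m≤o∸n (k * γ) kγ+c≤2kc ⟩
    c * (2 * k) ∸ c * 1   ≡⟨ *-distribˡ-∸ c (2 * k) 1 ⟨
    c * (2 * k ∸ 1)       ≤⟨ *-monoʳ-≤ c (∸-monoˡ-≤ 1 (m≤m+n (2 * k) b)) ⟩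
    c * (2 * k + b ∸ 1)   ∎
    where
    open ≤-Reasoning
    regroup : ∀ k c → k * (c + c) ≡ c * (2 * k)
    regroup = solve-∀
    kγ+c≤2kc : k * γ + c * 1 ≤ c * (2 * k)
    kγ+c≤2kc = begin
      k * γ + c * 1   ≤⟨ +-monoʳ-≤ (k * γ) (≤-trans (≤-reflexive (*-identityʳ c)) c≤k) ⟩
      k * γ + k       ≡⟨ trans (+-comm (k * γ) k) (sym (*-suc k γ)) ⟩
      k * suc γ       ≤⟨ *-monoʳ-≤ k γ<c+c ⟩
      k * (c + c)     ≡⟨ regroup k c ⟩
      c * (2 * k)     ∎

open import Data.Nat using (ℕ; NonZero; _+_; _*_; _∸_; _≤_; _<_)
open import Data.Nat.Divisibility using (_∣_)
open import Data.Nat.DivMod using (_/_; _%_)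
open import Data.Product using (_×_)
open import Relation.Nullary using (¬_)

open import Data.Nat using (zero; suc; s≤s; z≤n)
open import Data.Nat.Properties using (*-comm; +-monoˡ-≤; <⇒≤; m≤n+m)
open import Data.Nat.Divisibility using (1∣_)
open import Data.Product using (_,_)
open import Relation.Binary.PropositionalEquality using (subst)
open import Relation.Nullary using (contradiction)
open Construction using (m1J≤-mono; module Shifted)
open Multipliers using (Multiplier; multiplier; k*γ≤c*[2k+b∸1])

proposition7 : (n k γ : ℕ) → 2 ∣ k → 1 ≤ k → k < n
    → .⦃ _ : NonZero γ ⦄ → ¬ (γ ∣ k) → ((d : ℕ) → 1 ≤ d → d < γ → d ∣ k)
    → ((γ ∣ n) → m1J≤ n k (((γ / 2) + 1) * k + 1))
      × (¬ (γ ∣ n) → m1J≤ n k (((γ / 2) + 1) * (2 * k + (n ∸ (k + 1)) % γ ∸ 1) + 1))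
proposition7 n k 0 _ _ _ ⦃ () ⦄
proposition7 n k 1 _ _ _ γ∤k _ = contradiction (1∣ k) γ∤k
proposition7 n k 2 2∣k _ _ γ∤k _ = contradiction 2∣k γ∤k
proposition7 n k γ@(suc (suc (suc _))) 2∣k 1≤k k<n γ∤k divisors =
  (λ γ∣n → subst (λ b → m1J≤ n k (b + 1)) (*-comm k c)
              (γ∣n⇒m1J≤[k*c+1] (<⇒≤ c<γ) (<⇒≤ γ<c+c) γ∤k*c γ∣n 1≤k k<n)) ,
  (λ _ → m1J≤-mono (m1J≤[k*γ+1] (<⇒≤ c<γ) (m≤n+m 1 (γ / 2)) γ∤k*c 1≤k k<n)
            (+-monoˡ-≤ 1 (k*γ≤c*[2k+b∸1] ((n ∸ (k + 1)) % γ) γ<c+c c≤k)))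
  where
  c = γ / 2 + 1
  open Multiplier (multiplier 1≤k divisors (s≤s (s≤s (s≤s z≤n))) 2∣k γ∤k)
  open Shifted c γ
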